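{- For every integer $n\geq 2$, \[ x\sum_{k=1}^{n}\binom{n}{k}{}_{H}w_{k}(x)=(x+1)\,{}_{H}w_{n}(x)-(x+1)\,w_{n-1}(x). \]
   Context: $\left\{ {n \atop k}\right\}$ denotes the Stirling number of the second kind. $H_k=\sum_{i=1}^k 1/i$ is the $k$-th harmonic number. The geometric polynomials are $w_m(x)=\sum_{k=0}^{m}\left\{ {m \atop k}\right\} k!\,x^k$, and the harmonic geometric polynomials are ${}_{H}w_m(x)=\sum_{k=1}^{m}\left\{ {m \atop k}\right\} k!\,H_k\,x^k$. -}

module Defs where

open import Data.Nat using (ℕ; zero; suc; _!; _∸_) renaming (_+_ to _+ℕ_; _*_ to _*ℕ_)
open import Data.Integer using (+_)
open import Data.Rational using (ℚ; 0ℚ; 1ℚ; _+_; _*_; _/_)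

stirling2 : ℕ → ℕ → ℕ
stirling2 zero    zero    = 1
stirling2 zero    (suc k) = 0
stirling2 (suc n) zero    = 0
stirling2 (suc n) (suc k) = suc k *ℕ stirling2 n (suc k) +ℕ stirling2 n k

ℕ→ℚ : ℕ → ℚ
ℕ→ℚ n = (+ n) / 1

sumBelow : ℕ → (ℕ → ℚ) → ℚ
sumBelow zero    f = 0ℚ
sumBelow (suc n) f = sumBelow n f + f n

-- Σ_{k=a}^{b} f k  (empty when b < a)
sumFromTo : ℕ → ℕ → (ℕ → ℚ) → ℚ
sumFromTo a b f = sumBelow (suc b ∸ a) (λ i → f (a +ℕ i))

_^_ : ℚ → ℕ → ℚ
x ^ zero  = 1ℚ
x ^ suc k = x * (x ^ k)

harmonic : ℕ → ℚ
harmonic zero    = 0ℚ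
harmonic (suc k) = harmonic k + (+ 1) / suc k

geomPoly : ℕ → ℚ → ℚ
geomPoly m x = sumFromTo 0 m (λ k → ℕ→ℚ (stirling2 m k *ℕ k !) * (x ^ k))

harmGeomPoly : ℕ → ℚ → ℚ
harmGeomPoly m x = sumFromTo 1 m (λ k → ℕ→ℚ (stirling2 m k *ℕ k !) * harmonic k * (x ^ k))

{-# OPTIONS --safe #-}

-- Compare coefficients.  Since w_k(x) = Σ_j S(k,j) j! x^j, the convolution
-- S(n+1,j+1) = Σ_k C(n,k) S(k,j) turns the left-hand side into Σ_j S(n+1,j+1) j! H_j x^(j+1).
-- On the right the coefficient of x^(j+1) is
--   S(n,j) j! H_j + S(n,j+1) (j+1)! H_(j+1) - S(n-1,j) j! - S(n-1,j+1) (j+1)!;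
-- splitting H_(j+1) = H_j + 1/(j+1) and using S(k+1,j+1) j! = S(k,j+1) (j+1)! + S(k,j) j!,
-- first for k = n-1 (which cancels the w_(n-1) terms) and then for k = n, leaves S(n+1,j+1) j! H_j.
-- The constant terms agree because S(n-1,0) = 0, which is where n ≥ 2 is needed.
module Submission where

open import Defs
open import Data.Nat using (ℕ; _≤_; _∸_)
open import Data.Nat.Combinatorics using (_C_)
open import Data.Rational using (ℚ; 1ℚ; _+_; _-_; _*_)
open import Relation.Binary.PropositionalEquality using (_≡_)

open import Data.Nat as ℕ using (zero; suc; _<_; _≤′_; _!; s≤s; z≤n)
open import Data.Nat.Combinatorics using (nCk+nC[k+1]≡[n+1]C[k+1]; k>n⇒nCk≡0)
open import Data.Nat.Properties as ℕ using (≤⇒≤′; ≤′⇒≤; m<n⇒m<1+n; n<1+n)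
import Data.Nat.Tactic.RingSolver as ℕ-Solver
import Data.Integer as ℤ
open import Data.Integer.Properties using (pos-+; pos-*)
import Data.Integer.Tactic.RingSolver as ℤ-Solver
open import Data.Rational using (0ℚ; _/_; toℚᵘ)
open import Data.Rational.Properties
  using ( _≟_; +-*-commutativeRing; toℚᵘ-injective; toℚᵘ-fromℚᵘ; toℚᵘ-homo-+; toℚᵘ-homo-*
        ; +-identityˡ; +-identityʳ; *-assoc; *-zeroˡ; *-zeroʳ; *-distribˡ-+; *-distribʳ-+ )
open import Data.Rational.Unnormalised as ℚᵘ using (mkℚᵘ; *≡*) renaming (_≃_ to _≃ᵘ_)
import Data.Rational.Unnormalised.Properties as ℚᵘ
open import Relation.Nullary.Decidable using (dec⇒maybe)
open import Relation.Binary.PropositionalEquality using (refl; sym; trans; cong; cong₂; module ≡-Reasoning)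
open import Tactic.RingSolver using (solve-∀)
open import Tactic.RingSolver.Core.AlmostCommutativeRing using (AlmostCommutativeRing; fromCommutativeRing)

ℚ-ring : AlmostCommutativeRing _ _
ℚ-ring = fromCommutativeRing +-*-commutativeRing (λ q → dec⇒maybe (0ℚ ≟ q))

toℚᵘ-ℕ→ℚ : ∀ n → toℚᵘ (ℕ→ℚ n) ≃ᵘ mkℚᵘ (ℤ.+ n) 0
toℚᵘ-ℕ→ℚ n = toℚᵘ-fromℚᵘ (mkℚᵘ (ℤ.+ n) 0)

ℕ→ℚ-homo-+ : ∀ m n → ℕ→ℚ (m ℕ.+ n) ≡ ℕ→ℚ m + ℕ→ℚ n
ℕ→ℚ-homo-+ m n = toℚᵘ-injective (begin
  toℚᵘ (ℕ→ℚ (m ℕ.+ n))                ≈⟨ toℚᵘ-ℕ→ℚ (m ℕ.+ n) ⟩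
  mkℚᵘ (ℤ.+ (m ℕ.+ n)) 0              ≈⟨ *≡* (trans (cong (ℤ._* ℤ.1ℤ) (pos-+ m n)) (ring (ℤ.+ m) (ℤ.+ n))) ⟩
  mkℚᵘ (ℤ.+ m) 0 ℚᵘ.+ mkℚᵘ (ℤ.+ n) 0  ≈⟨ ℚᵘ.+-cong (toℚᵘ-ℕ→ℚ m) (toℚᵘ-ℕ→ℚ n) ⟨
  toℚᵘ (ℕ→ℚ m) ℚᵘ.+ toℚᵘ (ℕ→ℚ n)      ≈⟨ toℚᵘ-homo-+ (ℕ→ℚ m) (ℕ→ℚ n) ⟨
  toℚᵘ (ℕ→ℚ m + ℕ→ℚ n)                ∎)
  where
  open ℚᵘ.≃-Reasoning
  ring : ∀ a b → (a ℤ.+ b) ℤ.* ℤ.1ℤ ≡ (a ℤ.* ℤ.1ℤ ℤ.+ b ℤ.* ℤ.1ℤ) ℤ.* ℤ.1ℤ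
  ring = ℤ-Solver.solve-∀

ℕ→ℚ-homo-* : ∀ m n → ℕ→ℚ (m ℕ.* n) ≡ ℕ→ℚ m * ℕ→ℚ n
ℕ→ℚ-homo-* m n = toℚᵘ-injective (begin
  toℚᵘ (ℕ→ℚ (m ℕ.* n))                ≈⟨ toℚᵘ-ℕ→ℚ (m ℕ.* n) ⟩
  mkℚᵘ (ℤ.+ (m ℕ.* n)) 0              ≈⟨ *≡* (cong (ℤ._* ℤ.1ℤ) (pos-* m n)) ⟩
  mkℚᵘ (ℤ.+ m) 0 ℚᵘ.* mkℚᵘ (ℤ.+ n) 0  ≈⟨ ℚᵘ.*-cong (toℚᵘ-ℕ→ℚ m) (toℚᵘ-ℕ→ℚ n) ⟨
  toℚᵘ (ℕ→ℚ m) ℚᵘ.* toℚᵘ (ℕ→ℚ n)      ≈⟨ toℚᵘ-homo-* (ℕ→ℚ m) (ℕ→ℚ n) ⟨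
  toℚᵘ (ℕ→ℚ m * ℕ→ℚ n)                ∎)
  where open ℚᵘ.≃-Reasoning

ℕ→ℚ-*-cancel-/ : ∀ d m → ℕ→ℚ (suc d ℕ.* m) * (ℤ.1ℤ / suc d) ≡ ℕ→ℚ m
ℕ→ℚ-*-cancel-/ d m = toℚᵘ-injective (begin
  toℚᵘ (ℕ→ℚ (suc d ℕ.* m) * (ℤ.1ℤ / suc d))
    ≈⟨ toℚᵘ-homo-* (ℕ→ℚ (suc d ℕ.* m)) (ℤ.1ℤ / suc d) ⟩
  toℚᵘ (ℕ→ℚ (suc d ℕ.* m)) ℚᵘ.* toℚᵘ (ℤ.1ℤ / suc d)
    ≈⟨ ℚᵘ.*-cong (toℚᵘ-ℕ→ℚ (suc d ℕ.* m)) (toℚᵘ-fromℚᵘ (mkℚᵘ ℤ.1ℤ d)) ⟩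
  mkℚᵘ (ℤ.+ (suc d ℕ.* m)) 0 ℚᵘ.* mkℚᵘ ℤ.1ℤ d
    ≈⟨ *≡* eq ⟩
  mkℚᵘ (ℤ.+ m) 0
    ≈⟨ toℚᵘ-ℕ→ℚ m ⟨
  toℚᵘ (ℕ→ℚ m)
    ∎)
  where
  open ℚᵘ.≃-Reasoning
  ring : ∀ a b → (a ℤ.* b ℤ.* ℤ.1ℤ) ℤ.* ℤ.1ℤ ≡ b ℤ.* (ℤ.1ℤ ℤ.* a)
  ring = ℤ-Solver.solve-∀
  eq : (ℤ.+ (suc d ℕ.* m) ℤ.* ℤ.1ℤ) ℤ.* ℤ.1ℤ ≡ ℤ.+ m ℤ.* ℤ.+ (1 ℕ.* suc d)
  eq = trans (cong (λ z → (z ℤ.* ℤ.1ℤ) ℤ.* ℤ.1ℤ) (pos-* (suc d) m))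
       (trans (ring (ℤ.+ suc d) (ℤ.+ m)) (cong (ℤ.+ m ℤ.*_) (sym (pos-* 1 (suc d)))))

sumBelow-cong : ∀ n {f g : ℕ → ℚ} → (∀ i → i < n → f i ≡ g i) → sumBelow n f ≡ sumBelow n g
sumBelow-cong zero    f≡g = refl
sumBelow-cong (suc n) f≡g =
  cong₂ _+_ (sumBelow-cong n (λ i i<n → f≡g i (m<n⇒m<1+n i<n))) (f≡g n (n<1+n n))

sumBelow-head : ∀ n (f : ℕ → ℚ) → sumBelow (suc n) f ≡ f 0 + sumBelow n (λ i → f (suc i))
sumBelow-head zero    f = trans (+-identityˡ (f 0)) (sym (+-identityʳ (f 0)))
sumBelow-head (suc n) f = trans (cong (_+ f (suc n)) (sumBelow-head n f)) (ring (f 0) _ _)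
  where
  ring : ∀ a b c → (a + b) + c ≡ a + (b + c)
  ring = solve-∀ ℚ-ring

sumBelow-pad : ∀ {N L} (f : ℕ → ℚ) → N ≤ L → (∀ i → N ≤ i → f i ≡ 0ℚ) → sumBelow L f ≡ sumBelow N f
sumBelow-pad {N} f N≤L f≡0 = go (≤⇒≤′ N≤L)
  where
  go : ∀ {L} → N ≤′ L → sumBelow L f ≡ sumBelow N f
  go ℕ.≤′-refl                  = refl
  go {suc L} (ℕ.≤′-step N≤′L) =
    trans (cong₂ _+_ (go N≤′L) (f≡0 L (≤′⇒≤ N≤′L))) (+-identityʳ (sumBelow N f))

sumBelow-0ℚ : ∀ n → sumBelow n (λ _ → 0ℚ) ≡ 0ℚ
sumBelow-0ℚ zero    = refl
sumBelow-0ℚ (suc n) = trans (+-identityʳ _) (sumBelow-0ℚ n)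

sumBelow-distrib-+ : ∀ n (f g : ℕ → ℚ) → sumBelow n (λ i → f i + g i) ≡ sumBelow n f + sumBelow n g
sumBelow-distrib-+ zero    f g = refl
sumBelow-distrib-+ (suc n) f g =
  trans (cong (_+ (f n + g n)) (sumBelow-distrib-+ n f g)) (ring (sumBelow n f) (sumBelow n g) (f n) (g n))
  where
  ring : ∀ a b c d → (a + b) + (c + d) ≡ (a + c) + (b + d)
  ring = solve-∀ ℚ-ring

*-distribˡ-sumBelow : ∀ n c (f : ℕ → ℚ) → c * sumBelow n f ≡ sumBelow n (λ i → c * f i)
*-distribˡ-sumBelow zero    c f = *-zeroʳ c
*-distribˡ-sumBelow (suc n) c f =
  trans (*-distribˡ-+ c (sumBelow n f) (f n)) (cong (_+ c * f n) (*-distribˡ-sumBelow n c f))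

*-distribʳ-sumBelow : ∀ n c (f : ℕ → ℚ) → sumBelow n f * c ≡ sumBelow n (λ i → f i * c)
*-distribʳ-sumBelow zero    c f = *-zeroˡ c
*-distribʳ-sumBelow (suc n) c f =
  trans (*-distribʳ-+ c (sumBelow n f) (f n)) (cong (_+ f n * c) (*-distribʳ-sumBelow n c f))

sumBelow-comm : ∀ m n (g : ℕ → ℕ → ℚ) →
  sumBelow m (λ i → sumBelow n (g i)) ≡ sumBelow n (λ j → sumBelow m (λ i → g i j))
sumBelow-comm zero    n g = sym (sumBelow-0ℚ n)
sumBelow-comm (suc m) n g =
  trans (cong (_+ sumBelow n (g m)) (sumBelow-comm m n g)) (sym (sumBelow-distrib-+ n _ (g m)))

ℕ→ℚ-pascal : ∀ n k → ℕ→ℚ (suc n C suc k) ≡ ℕ→ℚ (n C k) + ℕ→ℚ (n C suc k)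
ℕ→ℚ-pascal n k = trans (cong ℕ→ℚ (sym (nCk+nC[k+1]≡[n+1]C[k+1] n k))) (ℕ→ℚ-homo-+ (n C k) (n C suc k))

sumBelow-binomial-suc : ∀ n (f : ℕ → ℚ) →
  sumBelow (suc (suc n)) (λ k → ℕ→ℚ (suc n C k) * f k)
    ≡ sumBelow (suc n) (λ k → ℕ→ℚ (n C k) * f k) + sumBelow (suc n) (λ k → ℕ→ℚ (n C k) * f (suc k))
sumBelow-binomial-suc n f = begin
  sumBelow (suc (suc n)) (λ k → ℕ→ℚ (suc n C k) * f k)
    ≡⟨ sumBelow-head (suc n) _ ⟩
  g 0 + sumBelow (suc n) (λ k → ℕ→ℚ (suc n C suc k) * f (suc k))
    ≡⟨ cong (g 0 +_) (trans (sumBelow-cong (suc n) (λ k _ → split k)) (sumBelow-distrib-+ (suc n) _ _)) ⟩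
  g 0 + (B + A)
    ≡⟨ ring (g 0) B A ⟩
  (g 0 + A) + B
    ≡⟨ cong (_+ B) (sym (sumBelow-head (suc n) g)) ⟩
  sumBelow (suc (suc n)) g + B
    ≡⟨ cong (_+ B) (sumBelow-pad g (ℕ.n≤1+n (suc n)) g-vanishes) ⟩
  sumBelow (suc n) g + B
    ∎
  where
  open ≡-Reasoning
  g : ℕ → ℚ
  g k = ℕ→ℚ (n C k) * f k
  A B : ℚ
  A = sumBelow (suc n) (λ k → ℕ→ℚ (n C suc k) * f (suc k))
  B = sumBelow (suc n) (λ k → ℕ→ℚ (n C k) * f (suc k))
  split : ∀ k → ℕ→ℚ (suc n C suc k) * f (suc k) ≡ ℕ→ℚ (n C k) * f (suc k) + ℕ→ℚ (n C suc k) * f (suc k)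
  split k = trans (cong (_* f (suc k)) (ℕ→ℚ-pascal n k))
                  (*-distribʳ-+ (f (suc k)) (ℕ→ℚ (n C k)) (ℕ→ℚ (n C suc k)))
  g-vanishes : ∀ k → suc n ≤ k → g k ≡ 0ℚ
  g-vanishes k n<k = trans (cong (λ c → ℕ→ℚ c * f k) (k>n⇒nCk≡0 n<k)) (*-zeroˡ (f k))
  ring : ∀ a b c → a + (b + c) ≡ (a + c) + b
  ring = solve-∀ ℚ-ring

ℕ→ℚ-stirling2-suc : ∀ k j →
  ℕ→ℚ (stirling2 (suc k) (suc j)) ≡ ℕ→ℚ (suc j) * ℕ→ℚ (stirling2 k (suc j)) + ℕ→ℚ (stirling2 k j)
ℕ→ℚ-stirling2-suc k j =
  trans (ℕ→ℚ-homo-+ (suc j ℕ.* stirling2 k (suc j)) (stirling2 k j))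
        (cong (_+ ℕ→ℚ (stirling2 k j)) (ℕ→ℚ-homo-* (suc j) (stirling2 k (suc j))))

sumBelow-*-stirling2-suc : ∀ n (a : ℕ → ℚ) j →
  sumBelow n (λ k → a k * ℕ→ℚ (stirling2 (suc k) (suc j)))
    ≡ ℕ→ℚ (suc j) * sumBelow n (λ k → a k * ℕ→ℚ (stirling2 k (suc j)))
        + sumBelow n (λ k → a k * ℕ→ℚ (stirling2 k j))
sumBelow-*-stirling2-suc n a j = begin
  sumBelow n (λ k → a k * ℕ→ℚ (stirling2 (suc k) (suc j)))
    ≡⟨ sumBelow-cong n (λ k _ → trans (cong (a k *_) (ℕ→ℚ-stirling2-suc k j))
                                      (distrib (a k) J (s k (suc j)) (s k j))) ⟩
  sumBelow n (λ k → J * (a k * s k (suc j)) + a k * s k j)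
    ≡⟨ sumBelow-distrib-+ n _ _ ⟩
  sumBelow n (λ k → J * (a k * s k (suc j))) + sumBelow n (λ k → a k * s k j)
    ≡⟨ cong (_+ sumBelow n (λ k → a k * s k j)) (*-distribˡ-sumBelow n J _) ⟨
  J * sumBelow n (λ k → a k * s k (suc j)) + sumBelow n (λ k → a k * s k j)
    ∎
  where
  open ≡-Reasoning
  J : ℚ
  J = ℕ→ℚ (suc j)
  s : ℕ → ℕ → ℚ
  s k m = ℕ→ℚ (stirling2 k m)
  distrib : ∀ a J s t → a * (J * s + t) ≡ J * (a * s) + a * t
  distrib = solve-∀ ℚ-ring

stirling2-binomial-convolution : ∀ n m →
  sumBelow (suc n) (λ k → ℕ→ℚ (n C k) * ℕ→ℚ (stirling2 k m)) ≡ ℕ→ℚ (stirling2 (suc n) (suc m))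
stirling2-binomial-convolution zero    zero    = refl
stirling2-binomial-convolution zero    (suc m) =
  cong ℕ→ℚ (sym (trans (ℕ.+-identityʳ _) (ℕ.*-zeroʳ (suc (suc m)))))
stirling2-binomial-convolution (suc n) zero    = begin
  sumBelow (suc (suc n)) (λ k → ℕ→ℚ (suc n C k) * ℕ→ℚ (stirling2 k 0))
    ≡⟨ sumBelow-binomial-suc n (λ k → ℕ→ℚ (stirling2 k 0)) ⟩
  T 0 + sumBelow (suc n) (λ k → ℕ→ℚ (n C k) * 0ℚ)
    ≡⟨ cong₂ _+_ (stirling2-binomial-convolution n 0)
                 (trans (sumBelow-cong (suc n) (λ k _ → *-zeroʳ (ℕ→ℚ (n C k)))) (sumBelow-0ℚ (suc n))) ⟩
  ℕ→ℚ (stirling2 (suc n) 1) + 0ℚ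
    ≡⟨ +-identityʳ _ ⟩
  ℕ→ℚ (stirling2 (suc n) 1)
    ≡⟨ cong ℕ→ℚ (trans (ℕ.+-identityʳ (1 ℕ.* s)) (ℕ.*-identityˡ s)) ⟨
  ℕ→ℚ (stirling2 (suc (suc n)) 1)
    ∎
  where
  open ≡-Reasoning
  s : ℕ
  s = stirling2 (suc n) 1
  T : ℕ → ℚ
  T m = sumBelow (suc n) (λ k → ℕ→ℚ (n C k) * ℕ→ℚ (stirling2 k m))
stirling2-binomial-convolution (suc n) (suc j) = begin
  sumBelow (suc (suc n)) (λ k → ℕ→ℚ (suc n C k) * ℕ→ℚ (stirling2 k (suc j)))
    ≡⟨ sumBelow-binomial-suc n (λ k → ℕ→ℚ (stirling2 k (suc j))) ⟩
  T (suc j) + sumBelow (suc n) (λ k → ℕ→ℚ (n C k) * ℕ→ℚ (stirling2 (suc k) (suc j)))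
    ≡⟨ cong (T (suc j) +_) (sumBelow-*-stirling2-suc (suc n) (λ k → ℕ→ℚ (n C k)) j) ⟩
  T (suc j) + (J * T (suc j) + T j)
    ≡⟨ cong₂ (λ a b → a + (J * a + b)) (stirling2-binomial-convolution n (suc j))
                                       (stirling2-binomial-convolution n j) ⟩
  a + (J * a + b)
    ≡⟨ ring a b J ⟩
  (1ℚ + J) * a + b
    ≡⟨ cong (λ c → c * a + b) (ℕ→ℚ-homo-+ 1 (suc j)) ⟨
  ℕ→ℚ (suc (suc j)) * a + b
    ≡⟨ ℕ→ℚ-stirling2-suc (suc n) (suc j) ⟨
  ℕ→ℚ (stirling2 (suc (suc n)) (suc (suc j)))
    ∎
  where
  open ≡-Reasoning
  T : ℕ → ℚ
  T m = sumBelow (suc n) (λ k → ℕ→ℚ (n C k) * ℕ→ℚ (stirling2 k m))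
  J a b : ℚ
  J = ℕ→ℚ (suc j)
  a = ℕ→ℚ (stirling2 (suc n) (suc (suc j)))
  b = ℕ→ℚ (stirling2 (suc n) (suc j))
  ring : ∀ a b J → a + (J * a + b) ≡ (1ℚ + J) * a + b
  ring = solve-∀ ℚ-ring

eval : ℕ → (ℕ → ℚ) → ℚ → ℚ
eval N c x = sumBelow N (λ m → c m * x ^ m)

shift : (ℕ → ℚ) → ℕ → ℚ
shift c zero    = 0ℚ
shift c (suc m) = c m

eval-cong : ∀ N {c d : ℕ → ℚ} x → (∀ m → c m ≡ d m) → eval N c x ≡ eval N d x
eval-cong N x c≡d = sumBelow-cong N (λ m _ → cong (_* x ^ m) (c≡d m))

eval-pad : ∀ {N L} (c : ℕ → ℚ) x → N ≤ L → (∀ i → N ≤ i → c i ≡ 0ℚ) → eval L c x ≡ eval N c x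
eval-pad c x N≤L c≡0 = sumBelow-pad _ N≤L (λ i N≤i → trans (cong (_* x ^ i) (c≡0 i N≤i)) (*-zeroˡ (x ^ i)))

eval-distrib-+ : ∀ N (c d : ℕ → ℚ) x → eval N (λ m → c m + d m) x ≡ eval N c x + eval N d x
eval-distrib-+ N c d x =
  trans (sumBelow-cong N (λ m _ → *-distribʳ-+ (x ^ m) (c m) (d m))) (sumBelow-distrib-+ N _ _)

eval-shift : ∀ N (c : ℕ → ℚ) x → eval (suc N) (shift c) x ≡ x * eval N c x
eval-shift N c x = begin
  eval (suc N) (shift c) x                  ≡⟨ sumBelow-head N _ ⟩
  0ℚ + sumBelow N (λ m → c m * x ^ suc m)   ≡⟨ +-identityˡ _ ⟩
  sumBelow N (λ m → c m * (x * x ^ m))      ≡⟨ sumBelow-cong N (λ m _ → ring (c m) x (x ^ m)) ⟩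
  sumBelow N (λ m → x * (c m * x ^ m))      ≡⟨ *-distribˡ-sumBelow N x _ ⟨
  x * eval N c x                            ∎
  where
  open ≡-Reasoning
  ring : ∀ a x y → a * (x * y) ≡ x * (a * y)
  ring = solve-∀ ℚ-ring

eval-shift-+ : ∀ N (c : ℕ → ℚ) x → (∀ i → N ≤ i → c i ≡ 0ℚ) →
  eval (suc N) (λ m → shift c m + c m) x ≡ (x + 1ℚ) * eval N c x
eval-shift-+ N c x c≡0 = begin
  eval (suc N) (λ m → shift c m + c m) x       ≡⟨ eval-distrib-+ (suc N) (shift c) c x ⟩
  eval (suc N) (shift c) x + eval (suc N) c x  ≡⟨ cong₂ _+_ (eval-shift N c x) (eval-pad c x (ℕ.n≤1+n N) c≡0) ⟩
  x * eval N c x + eval N c x                  ≡⟨ ring x (eval N c x) ⟩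
  (x + 1ℚ) * eval N c x                        ∎
  where
  open ≡-Reasoning
  ring : ∀ x e → x * e + e ≡ (x + 1ℚ) * e
  ring = solve-∀ ℚ-ring

eval-sumBelow : ∀ n N (a : ℕ → ℚ) (c : ℕ → ℕ → ℚ) x →
  eval N (λ m → sumBelow n (λ k → a k * c k m)) x ≡ sumBelow n (λ k → a k * eval N (c k) x)
eval-sumBelow n N a c x = begin
  sumBelow N (λ m → sumBelow n (λ k → a k * c k m) * x ^ m)
    ≡⟨ sumBelow-cong N (λ m _ → *-distribʳ-sumBelow n (x ^ m) _) ⟩
  sumBelow N (λ m → sumBelow n (λ k → a k * c k m * x ^ m))
    ≡⟨ sumBelow-comm n N (λ k m → a k * c k m * x ^ m) ⟨
  sumBelow n (λ k → sumBelow N (λ m → a k * c k m * x ^ m))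
    ≡⟨ sumBelow-cong n (λ k _ → sumBelow-cong N (λ m _ → *-assoc (a k) (c k m) (x ^ m))) ⟩
  sumBelow n (λ k → sumBelow N (λ m → a k * (c k m * x ^ m)))
    ≡⟨ sumBelow-cong n (λ k _ → *-distribˡ-sumBelow N (a k) _) ⟨
  sumBelow n (λ k → a k * eval N (c k) x)
    ∎
  where open ≡-Reasoning

k<j⇒stirling2≡0 : ∀ {k j} → k < j → stirling2 k j ≡ 0
k<j⇒stirling2≡0 {zero}  {suc j} _          = refl
k<j⇒stirling2≡0 {suc k} {suc j} (s≤s k<j) =
  trans (cong₂ (λ a b → suc j ℕ.* a ℕ.+ b) (k<j⇒stirling2≡0 (m<n⇒m<1+n k<j)) (k<j⇒stirling2≡0 k<j))
        (trans (ℕ.+-identityʳ (suc j ℕ.* 0)) (ℕ.*-zeroʳ (suc j)))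

geomCoeff : ℕ → ℕ → ℚ
geomCoeff k j = ℕ→ℚ (stirling2 k j ℕ.* j !)

harmGeomCoeff : ℕ → ℕ → ℚ
harmGeomCoeff k j = geomCoeff k j * harmonic j

k<j⇒geomCoeff≡0 : ∀ {k j} → k < j → geomCoeff k j ≡ 0ℚ
k<j⇒geomCoeff≡0 {j = j} k<j = cong (λ s → ℕ→ℚ (s ℕ.* j !)) (k<j⇒stirling2≡0 k<j)

k<j⇒harmGeomCoeff≡0 : ∀ {k j} → k < j → harmGeomCoeff k j ≡ 0ℚ
k<j⇒harmGeomCoeff≡0 {j = j} k<j = trans (cong (_* harmonic j) (k<j⇒geomCoeff≡0 k<j)) (*-zeroˡ (harmonic j))

geomPoly-eval : ∀ {k L} x → k < L → geomPoly k x ≡ eval L (geomCoeff k) x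
geomPoly-eval x k<L = sym (eval-pad _ x k<L (λ _ → k<j⇒geomCoeff≡0))

harmGeomPoly-eval : ∀ {k L} x → k < L → harmGeomPoly k x ≡ eval L (harmGeomCoeff k) x
harmGeomPoly-eval {k} {L} x k<L = begin
  harmGeomPoly k x                                       ≡⟨ +-identityˡ _ ⟨
  0ℚ + harmGeomPoly k x                                  ≡⟨ cong (_+ harmGeomPoly k x) constant-term ⟨
  harmGeomCoeff k 0 * x ^ 0 + harmGeomPoly k x           ≡⟨ sumBelow-head k _ ⟨
  eval (suc k) (harmGeomCoeff k) x                       ≡⟨ eval-pad _ x k<L (λ _ → k<j⇒harmGeomCoeff≡0) ⟨
  eval L (harmGeomCoeff k) x                             ∎
  where
  open ≡-Reasoning
  constant-term : harmGeomCoeff k 0 * x ^ 0 ≡ 0ℚ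
  constant-term = trans (cong (_* 1ℚ) (*-zeroʳ (geomCoeff k 0))) (*-zeroˡ 1ℚ)

stirling2-suc-*-! : ∀ k j → ℕ→ℚ (stirling2 (suc k) (suc j) ℕ.* j !) ≡ geomCoeff k (suc j) + geomCoeff k j
stirling2-suc-*-! k j =
  trans (cong ℕ→ℚ (ring (suc j) (stirling2 k (suc j)) (stirling2 k j) (j !)))
        (ℕ→ℚ-homo-+ (stirling2 k (suc j) ℕ.* suc j !) (stirling2 k j ℕ.* j !))
  where
  ring : ∀ n s t f → (n ℕ.* s ℕ.+ t) ℕ.* f ≡ s ℕ.* (n ℕ.* f) ℕ.+ t ℕ.* f
  ring = ℕ-Solver.solve-∀

geomCoeff-harmonic-suc : ∀ k j →
  geomCoeff k (suc j) * harmonic (suc j) ≡ geomCoeff k (suc j) * harmonic j + ℕ→ℚ (stirling2 k (suc j) ℕ.* j !)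
geomCoeff-harmonic-suc k j =
  trans (*-distribˡ-+ (geomCoeff k (suc j)) (harmonic j) _) (cong (geomCoeff k (suc j) * harmonic j +_) last-term)
  where
  ring : ∀ n s f → s ℕ.* (n ℕ.* f) ≡ n ℕ.* (s ℕ.* f)
  ring = ℕ-Solver.solve-∀
  last-term : geomCoeff k (suc j) * (ℤ.1ℤ / suc j) ≡ ℕ→ℚ (stirling2 k (suc j) ℕ.* j !)
  last-term = trans (cong (λ m → ℕ→ℚ m * (ℤ.1ℤ / suc j)) (ring (suc j) (stirling2 k (suc j)) (j !)))
                    (ℕ→ℚ-*-cancel-/ j (stirling2 k (suc j) ℕ.* j !))

binomialSumCoeff : ℕ → ℕ → ℚ
binomialSumCoeff n j = ℕ→ℚ (stirling2 (suc n) (suc j) ℕ.* j !) * harmonic j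

sumBelow-binomial-harmGeomCoeff : ∀ n j →
  sumBelow (suc n) (λ k → ℕ→ℚ (n C k) * harmGeomCoeff k j) ≡ binomialSumCoeff n j
sumBelow-binomial-harmGeomCoeff n j = begin
  sumBelow (suc n) (λ k → ℕ→ℚ (n C k) * harmGeomCoeff k j)
    ≡⟨ sumBelow-cong (suc n) (λ k _ → factor k) ⟩
  sumBelow (suc n) (λ k → ℕ→ℚ (n C k) * ℕ→ℚ (stirling2 k j) * K)
    ≡⟨ *-distribʳ-sumBelow (suc n) K _ ⟨
  sumBelow (suc n) (λ k → ℕ→ℚ (n C k) * ℕ→ℚ (stirling2 k j)) * K
    ≡⟨ cong (_* K) (stirling2-binomial-convolution n j) ⟩
  ℕ→ℚ (stirling2 (suc n) (suc j)) * K
    ≡⟨ factor-S (stirling2 (suc n) (suc j)) ⟨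
  binomialSumCoeff n j
    ∎
  where
  open ≡-Reasoning
  K : ℚ
  K = ℕ→ℚ (j !) * harmonic j
  factor-S : ∀ s → ℕ→ℚ (s ℕ.* j !) * harmonic j ≡ ℕ→ℚ s * K
  factor-S s = trans (cong (_* harmonic j) (ℕ→ℚ-homo-* s (j !))) (*-assoc (ℕ→ℚ s) (ℕ→ℚ (j !)) (harmonic j))
  factor : ∀ k → ℕ→ℚ (n C k) * harmGeomCoeff k j ≡ ℕ→ℚ (n C k) * ℕ→ℚ (stirling2 k j) * K
  factor k = trans (cong (ℕ→ℚ (n C k) *_) (factor-S (stirling2 k j))) (sym (*-assoc (ℕ→ℚ (n C k)) _ K))

binomial-sum-harmGeomPoly : ∀ n x →
  sumFromTo 1 n (λ k → ℕ→ℚ (n C k) * harmGeomPoly k x) ≡ eval (suc n) (binomialSumCoeff n) x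
binomial-sum-harmGeomPoly n x = begin
  sumFromTo 1 n (λ k → ℕ→ℚ (n C k) * harmGeomPoly k x)
    ≡⟨ +-identityˡ _ ⟨
  0ℚ + sumFromTo 1 n (λ k → ℕ→ℚ (n C k) * harmGeomPoly k x)
    ≡⟨ sumBelow-head n _ ⟨
  sumBelow (suc n) (λ k → ℕ→ℚ (n C k) * harmGeomPoly k x)
    ≡⟨ sumBelow-cong (suc n) (λ k k<1+n → cong (ℕ→ℚ (n C k) *_) (harmGeomPoly-eval x k<1+n)) ⟩
  sumBelow (suc n) (λ k → ℕ→ℚ (n C k) * eval (suc n) (harmGeomCoeff k) x)
    ≡⟨ eval-sumBelow (suc n) (suc n) (λ k → ℕ→ℚ (n C k)) harmGeomCoeff x ⟨
  eval (suc n) (λ j → sumBelow (suc n) (λ k → ℕ→ℚ (n C k) * harmGeomCoeff k j)) x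
    ≡⟨ eval-cong (suc n) x (sumBelow-binomial-harmGeomCoeff n) ⟩
  eval (suc n) (binomialSumCoeff n) x
    ∎
  where open ≡-Reasoning

binomialSumCoeff-suc : ∀ p j →
  binomialSumCoeff (suc p) j + (geomCoeff p j + geomCoeff p (suc j))
    ≡ harmGeomCoeff (suc p) j + harmGeomCoeff (suc p) (suc j)
binomialSumCoeff-suc p j = begin
  ℕ→ℚ (stirling2 (suc n) (suc j) ℕ.* j !) * H + (G p j + G p (suc j))
    ≡⟨ cong (λ s → s * H + (G p j + G p (suc j))) (stirling2-suc-*-! n j) ⟩
  (G n (suc j) + G n j) * H + (G p j + G p (suc j))
    ≡⟨ ring (G n (suc j)) (G n j) H (G p j) (G p (suc j)) ⟩
  G n j * H + (G n (suc j) * H + (G p (suc j) + G p j))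
    ≡⟨ cong (λ s → G n j * H + (G n (suc j) * H + s)) (stirling2-suc-*-! p j) ⟨
  G n j * H + (G n (suc j) * H + ℕ→ℚ (stirling2 n (suc j) ℕ.* j !))
    ≡⟨ cong (G n j * H +_) (geomCoeff-harmonic-suc n j) ⟨
  G n j * H + G n (suc j) * harmonic (suc j)
    ∎
  where
  open ≡-Reasoning
  n : ℕ
  n = suc p
  G : ℕ → ℕ → ℚ
  G = geomCoeff
  H : ℚ
  H = harmonic j
  ring : ∀ a b h c d → (a + b) * h + (c + d) ≡ b * h + (a * h + (d + c))
  ring = solve-∀ ℚ-ring

coefficients-agree : ∀ p m →
  shift (binomialSumCoeff (suc (suc p))) m + (shift (geomCoeff (suc p)) m + geomCoeff (suc p) m)
    ≡ shift (harmGeomCoeff (suc (suc p))) m + harmGeomCoeff (suc (suc p)) m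
coefficients-agree p zero    = refl
coefficients-agree p (suc j) = binomialSumCoeff-suc (suc p) j

x*binomialSum+[x+1]*geomPoly≡[x+1]*harmGeomPoly : ∀ p x → let n = suc (suc p) in
  x * eval (suc n) (binomialSumCoeff n) x + (x + 1ℚ) * geomPoly (suc p) x ≡ (x + 1ℚ) * harmGeomPoly n x
x*binomialSum+[x+1]*geomPoly≡[x+1]*harmGeomPoly p x = begin
  x * eval (suc n) a x + (x + 1ℚ) * geomPoly (suc p) x
    ≡⟨ cong₂ _+_ (sym (eval-shift (suc n) a x))
                 (trans (cong ((x + 1ℚ) *_) (geomPoly-eval x (m<n⇒m<1+n (n<1+n (suc p)))))
                        (sym (eval-shift-+ (suc n) g x (λ _ n<i → k<j⇒geomCoeff≡0 (ℕ.<⇒≤ n<i))))) ⟩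
  eval L (shift a) x + eval L (λ m → shift g m + g m) x
    ≡⟨ eval-distrib-+ L (shift a) _ x ⟨
  eval L (λ m → shift a m + (shift g m + g m)) x
    ≡⟨ eval-cong L x (coefficients-agree p) ⟩
  eval L (λ m → shift h m + h m) x
    ≡⟨ eval-shift-+ (suc n) h x (λ _ → k<j⇒harmGeomCoeff≡0) ⟩
  (x + 1ℚ) * eval (suc n) h x
    ≡⟨ cong ((x + 1ℚ) *_) (harmGeomPoly-eval x (n<1+n n)) ⟨
  (x + 1ℚ) * harmGeomPoly n x
    ∎
  where
  open ≡-Reasoning
  n L : ℕ
  n = suc (suc p)
  L = suc (suc n)
  a g h : ℕ → ℚ
  a = binomialSumCoeff n
  g = geomCoeff (suc p)
  h = harmGeomCoeff n

proposition1 : (n : ℕ) → 2 ≤ n → (x : ℚ) →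
    x * sumFromTo 1 n (λ k → ℕ→ℚ (n C k) * harmGeomPoly k x)
      ≡ (x + 1ℚ) * harmGeomPoly n x - (x + 1ℚ) * geomPoly (n ∸ 1) x
proposition1 n@(suc (suc p)) (s≤s (s≤s z≤n)) x = begin
  x * sumFromTo 1 n (λ k → ℕ→ℚ (n C k) * harmGeomPoly k x)
    ≡⟨ cong (x *_) (binomial-sum-harmGeomPoly n x) ⟩
  x * A
    ≡⟨ ring (x * A) ((x + 1ℚ) * W) ⟩
  x * A + (x + 1ℚ) * W - (x + 1ℚ) * W
    ≡⟨ cong (_- (x + 1ℚ) * W) (x*binomialSum+[x+1]*geomPoly≡[x+1]*harmGeomPoly p x) ⟩
  (x + 1ℚ) * harmGeomPoly n x - (x + 1ℚ) * W
    ∎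
  where
  open ≡-Reasoning
  A W : ℚ
  A = eval (suc n) (binomialSumCoeff n) x
  W = geomPoly (suc p) x
  ring : ∀ a b → a ≡ a + b - b
  ring = solve-∀ ℚ-ring
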